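{- Let $X,Y$ be $\mathfrak{Q}$-preordered $\mathfrak{Q}$-subsets and $g\colon\mathsf{P}^\dagger Y\to\mathsf{P}^\dagger X$ a $\mathfrak{Q}$-order-preserving map. The following are equivalent: (i) $g$ is a right adjoint, i.e. there exists a $\mathfrak{Q}$-order-preserving $f\colon\mathsf{P}^\dagger X\to\mathsf{P}^\dagger Y$ with $f\dashv g$ a $\mathfrak{Q}$-Galois connection; (ii) $g$ is a right adjoint between the underlying preordered sets of $\mathsf{P}^\dagger Y$ and $\mathsf{P}^\dagger X$, and $g(\lambda\circ v)=g\lambda\circ v$ for all $\lambda\in\mathsf{P}^\dagger Y$, $q\in\mathfrak{Q}$ and $v\in\mathcal{D}\mathfrak{Q}(q,|\lambda|)$; (iii) $g$ is a right adjoint between the underlying preordered sets of $\mathsf{P}^\dagger Y$ and $\mathsf{P}^\dagger X$, and $g(\mathsf{y}^\dagger_Y y\circ v)=g\mathsf{y}^\dagger_Y y\circ v$ for all $y\in Y$, $q\in\mathfrak{Q}$ and $v\in\mathcal{D}\mathfrak{Q}(q,|y|)$.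
   Context: $(\mathfrak{Q},\&,e)$ is a unital quantale (complete lattice with an associative multiplication $\&$ with unit $e$, distributing over arbitrary joins in each variable), assumed non-trivial ($\bot<e$). Implications: $p\& q\le r\iff p\le r/q\iff q\le p\backslash r$. $\mathcal{D}\mathfrak{Q}(p,q)=\{u\in\mathfrak{Q}: (u/p)\& p=u=q\&(q\backslash u)\}$. A $\mathfrak{Q}$-subset is a set $X$ with a map $|\cdot|\colon X\to\mathfrak{Q}$. A $\mathfrak{Q}$-relation $\phi\colon X\nrightarrow Y$ is a map $X\times Y\to\mathfrak{Q}$ with $\phi(x,y)\in\mathcal{D}\mathfrak{Q}(|x|,|y|)$. Composition: $(\psi\circ\phi)(x,z)=\bigvee_{y}(\psi(y,z)/|y|)\&\phi(x,y)$; identity $\mathrm{id}_X(x,x')=|x|$ if $x=x'$, $\bot$ otherwise; pointwise order. $\psi\searrow\xi$ (for $\psi\colon Y\nrightarrow Z$, $\xi\colon X\nrightarrow Z$) is the join of all $\phi'\colon X\nrightarrow Y$ with $\psi\circ\phi'\le\xi$. $\mathbf{1}_q$ is the singleton $\{*\}$ with $|*|=q$; an element $v\in\mathcal{D}\mathfrak{Q}(p,q)$ is regarded as the $\mathfrak{Q}$-relation $\mathbf{1}_p\nrightarrow\mathbf{1}_q$ with value $v$. A $\mathfrak{Q}$-preordered $\mathfrak{Q}$-subset is a $\mathfrak{Q}$-subset $X$ with $1_X^\natural\colon X\nrightarrow X$, $\mathrm{id}_X\le 1_X^\natural$, $1_X^\natural\circ 1_X^\natural\le 1_X^\natural$. $\mathfrak{Q}$-order-preserving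 map: $|fx|=|x|$ and $1_X^\natural(x,x')\le 1_Y^\natural(fx,fx')$. Underlying preorder: $x\le y$ iff $|x|=|y|$ and $|x|\le 1_X^\natural(x,y)$; maps compared pointwise. $\mathfrak{Q}$-Galois connection $f\dashv g$: $\mathfrak{Q}$-order-preserving $f,g$ with $1\le gf$, $fg\le 1$. A right adjoint between preordered sets is a monotone map having a monotone left adjoint in the usual sense. $\mathsf{P}^\dagger X$: all $\lambda\colon\mathbf{1}_q\nrightarrow X$ ($q\in\mathfrak{Q}$) with $1_X^\natural\circ\lambda\le\lambda$, $|\lambda|=q$, $1_{\mathsf{P}^\dagger X}^\natural(\lambda,\lambda')=\lambda'\searrow\lambda$ (so its underlying preorder is the reverse of pointwise inclusion among relations of equal membership). The co-Yoneda embedding is $\mathsf{y}^\dagger_X\colon X\to\mathsf{P}^\dagger X$, $\mathsf{y}^\dagger_Xx=1_X^\natural(x,-)\colon\mathbf{1}_{|x|}\nrightarrow X$. -}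

module Defs where

open import Data.Unit using (⊤; tt)
open import Data.Empty using () renaming (⊥ to Empty)
open import Data.Bool using (Bool; true; false)
open import Data.Product using (Σ; _×_; _,_; proj₁; proj₂; Σ-syntax)
open import Relation.Binary.PropositionalEquality
open import Function.Bundles using (_⇔_)

record Quantale : Set₁ where
  infix 4 _≤_
  infixl 7 _&_
  field
    Carrier   : Set
    _≤_       : Carrier → Carrier → Set
    ≤-refl    : ∀ {a} → a ≤ a
    ≤-trans   : ∀ {a b c} → a ≤ b → b ≤ c → a ≤ c
    ≤-antisym : ∀ {a b} → a ≤ b → b ≤ a → a ≡ b
    ⋁         : {I : Set} → (I → Carrier) → Carrier
    ⋁-upper   : ∀ {I} (f : I → Carrier) (i : I) → f i ≤ ⋁ f
    ⋁-least   : ∀ {I} (f : I → Carrier) {a} → (∀ i → f i ≤ a) → ⋁ f ≤ a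
    _&_       : Carrier → Carrier → Carrier
    e         : Carrier
    &-assoc     : ∀ a b c → (a & b) & c ≡ a & (b & c)
    &-identityˡ : ∀ a → e & a ≡ a
    &-identityʳ : ∀ a → a & e ≡ a
    &-distribˡ-⋁ : ∀ a {I} (f : I → Carrier) → a & ⋁ f ≡ ⋁ (λ i → a & f i)
    &-distribʳ-⋁ : ∀ {I} (f : I → Carrier) a → ⋁ f & a ≡ ⋁ (λ i → f i & a)

module Theory (Q : Quantale) where
  open Quantale Q

  ⊥Q : Carrier
  ⊥Q = ⋁ {Empty} (λ ())

  -- implications:  p & q ≤ r ⇔ p ≤ r / q ⇔ q ≤ p \ r
  infixl 8 _/_ _\\_
  _/_ : Carrier → Carrier → Carrier
  r / q = ⋁ {Σ Carrier (λ p → p & q ≤ r)} proj₁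

  _\\_ : Carrier → Carrier → Carrier
  p \\ r = ⋁ {Σ Carrier (λ x → p & x ≤ r)} proj₁

  DQ : Carrier → Carrier → Carrier → Set
  DQ p q u = ((u / p) & p ≡ u) × (q & (q \\ u) ≡ u)

  record QSubset : Set₁ where
    field
      Elt : Set
      ∣_∣ : Elt → Carrier
  open QSubset public

  Rel : QSubset → QSubset → Set
  Rel X Y = Elt X → Elt Y → Carrier

  IsQRel : (X Y : QSubset) → Rel X Y → Set
  IsQRel X Y φ = ∀ x y → DQ (∣ X ∣ x) (∣ Y ∣ y) (φ x y)

  LeR : (X Y : QSubset) → Rel X Y → Rel X Y → Set
  LeR X Y φ ψ = ∀ x y → φ x y ≤ ψ x y

  EqR : (X Y : QSubset) → Rel X Y → Rel X Y → Set
  EqR X Y φ ψ = ∀ x y → φ x y ≡ ψ x y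

  comp : (X Y Z : QSubset) → Rel Y Z → Rel X Y → Rel X Z
  comp X Y Z ψ φ x z = ⋁ (λ y → (ψ y z / ∣ Y ∣ y) & φ x y)

  -- identity: |x| if x = x', ⊥ otherwise (written as a join over x ≡ x')
  idR : (X : QSubset) → Rel X X
  idR X x x' = ⋁ {x ≡ x'} (λ _ → ∣ X ∣ x)

  lift : (X Y Z : QSubset) → Rel Y Z → Rel X Z → Rel X Y
  lift X Y Z ψ ξ x y =
    ⋁ {Σ[ φ' ∈ Rel X Y ] (IsQRel X Y φ' × (LeR X Z (comp X Y Z ψ φ') ξ))} (λ w → proj₁ w x y)

  𝟏 : Carrier → QSubset
  𝟏 q = record { Elt = ⊤ ; ∣_∣ = λ _ → q }

  record QPreSet : Set₁ where
    field
      sub : QSubset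
      hom : Rel sub sub
  open QPreSet public

  record QPreordered : Set₁ where
    field
      pre      : QPreSet
      isRel    : IsQRel (sub pre) (sub pre) (hom pre)
      refl-ax  : LeR (sub pre) (sub pre) (idR (sub pre)) (hom pre)
      trans-ax : LeR (sub pre) (sub pre) (comp (sub pre) (sub pre) (sub pre) (hom pre) (hom pre)) (hom pre)
  open QPreordered public

  IsQOrderPreserving : (A B : QPreSet) → (Elt (sub A) → Elt (sub B)) → Set
  IsQOrderPreserving A B f =
    (∀ x → ∣ sub B ∣ (f x) ≡ ∣ sub A ∣ x) ×
    (∀ x x' → hom A x x' ≤ hom B (f x) (f x'))

  Under : (A : QPreSet) → Elt (sub A) → Elt (sub A) → Set
  Under A x y = (∣ sub A ∣ x ≡ ∣ sub A ∣ y) × (∣ sub A ∣ x ≤ hom A x y)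

  Monotone : (A B : QPreSet) → (Elt (sub A) → Elt (sub B)) → Set
  Monotone A B f = ∀ x y → Under A x y → Under B (f x) (f y)

  IsQGalois : (A B : QPreSet) → (Elt (sub A) → Elt (sub B)) → (Elt (sub B) → Elt (sub A)) → Set
  IsQGalois A B f g =
    IsQOrderPreserving A B f × IsQOrderPreserving B A g ×
    (∀ a → Under A a (g (f a))) × (∀ b → Under B (f (g b)) b)

  IsRightAdjointPre : (A B : QPreSet) → (Elt (sub B) → Elt (sub A)) → Set
  IsRightAdjointPre A B g =
    Monotone B A g ×
    Σ[ f ∈ (Elt (sub A) → Elt (sub B)) ]
      (Monotone A B f × (∀ a b → Under B (f a) b ⇔ Under A a (g b)))

  record PElt (X : QPreordered) : Set where
    field
      mem    : Carrier
      rel    : Rel (𝟏 mem) (sub (pre X))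
      isRelP : IsQRel (𝟏 mem) (sub (pre X)) rel
      closed : LeR (𝟏 mem) (sub (pre X)) (comp (𝟏 mem) (sub (pre X)) (sub (pre X)) (hom (pre X)) rel) rel
  open PElt public

  P† : QPreordered → QPreSet
  P† X = record
    { sub = record { Elt = PElt X ; ∣_∣ = mem }
    ; hom = λ l l' → lift (𝟏 (mem l)) (𝟏 (mem l')) (sub (pre X)) (rel l') (rel l) tt tt
    }

  y† : (X : QPreordered) → Elt (sub (pre X)) → PElt X
  y† X x = record
    { mem = ∣ sub (pre X) ∣ x
    ; rel = λ _ x' → hom (pre X) x x'
    ; isRelP = λ _ x' → isRel X x x'
    ; closed = λ _ z → trans-ax X x z
    }

  ≤-reflexive : ∀ {a b} → a ≡ b → a ≤ b
  ≤-reflexive refl = ≤-refl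

  private
    two : Carrier → Carrier → Bool → Carrier
    two a b true = b
    two a b false = a

    two-⋁ : ∀ {a b} → a ≤ b → ⋁ (two a b) ≡ b
    two-⋁ {a} {b} h = ≤-antisym (⋁-least (two a b) λ { true → ≤-refl ; false → h })
                                 (⋁-upper (two a b) true)

  &-monoˡ : ∀ {a b} c → a ≤ b → a & c ≤ b & c
  &-monoˡ {a} {b} c h =
    ≤-trans (⋁-upper (λ i → two a b i & c) false)
     (≤-reflexive (trans (sym (&-distribʳ-⋁ (two a b) c)) (cong (_& c) (two-⋁ h))))

  &-monoʳ : ∀ {a b} c → a ≤ b → c & a ≤ c & b
  &-monoʳ {a} {b} c h =
    ≤-trans (⋁-upper (λ i → c & two a b i) false)
     (≤-reflexive (trans (sym (&-distribˡ-⋁ c (two a b))) (cong (c &_) (two-⋁ h))))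

  /-intro : ∀ {a q r} → a & q ≤ r → a ≤ r / q
  /-intro {a} h = ⋁-upper proj₁ (a , h)

  /-counit : ∀ {q r} → (r / q) & q ≤ r
  /-counit {q} {r} = ≤-trans (≤-reflexive (&-distribʳ-⋁ proj₁ q)) (⋁-least _ proj₂)

  \\-intro : ∀ {a p r} → p & a ≤ r → a ≤ p \\ r
  \\-intro {a} h = ⋁-upper proj₁ (a , h)

  \\-counit : ∀ {p r} → p & (p \\ r) ≤ r
  \\-counit {p} {r} = ≤-trans (≤-reflexive (&-distribˡ-⋁ p proj₁)) (⋁-least _ proj₂)

  /-mono : ∀ {a b p} → a ≤ b → a / p ≤ b / p
  /-mono h = /-intro (≤-trans /-counit h)

  \\-mono : ∀ {a b p} → a ≤ b → p \\ a ≤ p \\ b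
  \\-mono h = \\-intro (≤-trans \\-counit h)

  DQ-⋁ : ∀ {I : Set} {p s} (u : I → Carrier) → (∀ i → DQ p s (u i)) → DQ p s (⋁ u)
  DQ-⋁ {p = p} {s} u d =
    ≤-antisym /-counit
      (⋁-least u λ i → ≤-trans (≤-reflexive (sym (proj₁ (d i))))
                                (&-monoˡ p (/-mono (⋁-upper u i)))) ,
    ≤-antisym \\-counit
      (⋁-least u λ i → ≤-trans (≤-reflexive (sym (proj₂ (d i))))
                                (&-monoʳ s (\\-mono (⋁-upper u i))))

  DQ-term : ∀ {q r s a b} → DQ r s a → DQ q r b → DQ q s ((a / r) & b)
  DQ-term {q} {r} {s} {a} {b} (a1 , a2) (b1 , b2) = part1 , part2
    where
    t = (a / r) & b
    h1 : ((a / r) & (b / q)) & q ≤ t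
    h1 = ≤-reflexive (trans (&-assoc _ _ _) (cong ((a / r) &_) b1))
    part1 : (t / q) & q ≡ t
    part1 = ≤-antisym /-counit
      (≤-trans (≤-reflexive (trans (cong ((a / r) &_) (sym b1)) (sym (&-assoc _ _ _))))
               (&-monoˡ q (/-intro h1)))
    eq : t ≡ (s & (s \\ a)) & (r \\ b)
    eq = trans (cong ((a / r) &_) (sym b2))
         (trans (sym (&-assoc _ _ _))
         (trans (cong (_& (r \\ b)) a1)
                (cong (_& (r \\ b)) (sym a2))))
    h2 : s & ((s \\ a) & (r \\ b)) ≤ t
    h2 = ≤-reflexive (trans (sym (&-assoc _ _ _)) (sym eq))
    part2 : s & (s \\ t) ≡ t
    part2 = ≤-antisym \\-counit
      (≤-trans (≤-reflexive (trans eq (&-assoc _ _ _))) (&-monoʳ s (\\-intro h2)))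

  &-/ : ∀ {a b p} → a & (b / p) ≤ (a & b) / p
  &-/ {a} {b} {p} = /-intro (≤-trans (≤-reflexive (&-assoc _ _ _)) (&-monoʳ a /-counit))

  -- λ ∘ v  for  λ ∈ 𝖯† X  and  v ∈ 𝒟𝔔(q, |λ|)  (v viewed as 𝟏_q ⇸ 𝟏_|λ|)
  compP : {X : QPreordered} (l : PElt X) (q v : Carrier) → DQ q (mem l) v → PElt X
  compP {X} l q v vd = record
    { mem = q
    ; rel = R
    ; isRelP = λ u y → DQ-⋁ _ (λ m → DQ-term (isRelP l m y) vd)
    ; closed = cl
    }
    where
    S = sub (pre X)
    p = mem l
    R : Rel (𝟏 q) S
    R = comp (𝟏 q) (𝟏 p) S (rel l) (λ _ _ → v)
    cl : LeR (𝟏 q) S (comp (𝟏 q) S S (hom (pre X)) R) R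
    cl u z = ⋁-least _ λ y →
      ≤-trans (≤-reflexive (&-distribˡ-⋁ _ _)) (⋁-least _ λ m →
        ≤-trans (≤-reflexive (sym (&-assoc _ _ _)))
        (≤-trans (&-monoˡ v &-/)
        (≤-trans (&-monoˡ v (/-mono (≤-trans (⋁-upper (λ y' → (hom (pre X) y' z / ∣ S ∣ y') & rel l m y') y) (closed l m z))))
                 (⋁-upper (λ m' → (rel l m' z / p) & v) m))))

  CondI : (X Y : QPreordered) → (PElt Y → PElt X) → Set
  CondI X Y g = Σ (PElt X → PElt Y) (λ f → IsQGalois (P† X) (P† Y) f g)

  CondII : (X Y : QPreordered) → (PElt Y → PElt X) → Set
  CondII X Y g =
    IsRightAdjointPre (P† X) (P† Y) g ×
    (∀ (l : PElt Y) (q v : Carrier) (d : DQ q (mem l) v) →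
       EqR (𝟏 q) (sub (pre X)) (rel (g (compP l q v d)))
           (comp (𝟏 q) (𝟏 (mem l)) (sub (pre X)) (rel (g l)) (λ _ _ → v)))

  CondIII : (X Y : QPreordered) → (PElt Y → PElt X) → Set
  CondIII X Y g =
    IsRightAdjointPre (P† X) (P† Y) g ×
    (∀ (y : Elt (sub (pre Y))) (q v : Carrier) (d : DQ q (∣ sub (pre Y) ∣ y) v) →
       EqR (𝟏 q) (sub (pre X)) (rel (g (compP (y† Y y) q v d)))
           (comp (𝟏 q) (𝟏 (∣ sub (pre Y) ∣ y)) (sub (pre X)) (rel (g (y† Y y))) (λ _ _ → v)))

-- In the underlying order of 𝖯† X an element is below another iff its relation
-- contains the other's, so unions of equal membership are meets and a right
-- adjoint g preserves them.  Every λ ∈ 𝖯† Y is the union of the y†y ∘ λ(y), and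
-- with (iii) this gives g(ν ∘ u) ⊆ gν ∘ u, which is exactly what makes the
-- left adjoint f 𝔔-order-preserving.  Conversely, for a 𝔔-Galois connection
-- both inclusions between g(λ ∘ v) and gλ ∘ v follow by transposing along f ⊣ g
-- the universal property of hom in 𝖯† X, which is a lift ↘.

module Submission where

open import Data.Product using (_×_; _,_; proj₁; proj₂)
open import Data.Unit using (⊤; tt)
open import Function.Base using (_∘_)
open import Function.Bundles using (_⇔_; mk⇔; Equivalence)
open import Relation.Binary.Bundles using (Poset)
open import Relation.Binary.PropositionalEquality
  using (_≡_; refl; sym; trans; cong; subst; isEquivalence)
import Relation.Binary.Reasoning.PartialOrder as PosetReasoning
open import Relation.Nullary using (¬_)

open import Defs

module CoPresheaves (Q : Quantale) where
  open Quantale Q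
  open Theory Q
  open Equivalence using (to; from)

  ≤-poset : Poset _ _ _
  ≤-poset = record
    { _≈_ = _≡_
    ; _≤_ = _≤_
    ; isPartialOrder = record
      { isPreorder = record
        { isEquivalence = isEquivalence ; reflexive = ≤-reflexive ; trans = ≤-trans }
      ; antisym = ≤-antisym
      }
    }

  open PosetReasoning ≤-poset

  ⋁-⊤ : (f : ⊤ → Carrier) → ⋁ f ≡ f tt
  ⋁-⊤ f = ≤-antisym (⋁-least f λ _ → ≤-refl) (⋁-upper f tt)

  DQ-refl : ∀ p → DQ p p p
  DQ-refl p =
    ≤-antisym /-counit (begin
      p            ≡⟨ &-identityˡ p ⟨
      e & p        ≤⟨ &-monoˡ p (/-intro (≤-reflexive (&-identityˡ p))) ⟩
      (p / p) & p  ∎) ,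
    ≤-antisym \\-counit (begin
      p             ≡⟨ &-identityʳ p ⟨
      p & e         ≤⟨ &-monoʳ p (\\-intro (≤-reflexive (&-identityʳ p))) ⟩
      p & (p \\ p)  ∎)

  infix 4 _≤̇_
  infixl 6 _∘[_]_

  _≤̇_ : {A : Set} → (A → Carrier) → (A → Carrier) → Set
  φ ≤̇ ψ = ∀ z → φ z ≤ ψ z

  -- φ ∘[ p ] v is the composite of φ : 𝟏_p ⇸ A with v : 𝟏_q ⇸ 𝟏_p.
  _∘[_]_ : {A : Set} → (A → Carrier) → Carrier → Carrier → A → Carrier
  (φ ∘[ p ] v) z = (φ z / p) & v

  ∘[]-mono : {A : Set} {φ ψ : A → Carrier} {p p' v : Carrier} →
             φ ≤̇ ψ → p ≡ p' → φ ∘[ p ] v ≤̇ ψ ∘[ p' ] v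
  ∘[]-mono φ≤ψ refl z = &-monoˡ _ (/-mono (φ≤ψ z))

  comp-𝟏 : (q p : Carrier) (S : QSubset) (ρ : Rel (𝟏 p) S) (v : Carrier) (z : Elt S) →
           comp (𝟏 q) (𝟏 p) S ρ (λ _ _ → v) tt z ≡ (ρ tt ∘[ p ] v) z
  comp-𝟏 q p S ρ v z = ⋁-⊤ _

  hom-refl : (X : QPreordered) (x : Elt (sub (pre X))) → ∣ sub (pre X) ∣ x ≤ hom (pre X) x x
  hom-refl X x = ≤-trans (⋁-upper _ refl) (refl-ax X x x)

  IsQOrderPreserving⇒Monotone : (A B : QPreSet) (f : Elt (sub A) → Elt (sub B)) →
                                IsQOrderPreserving A B f → Monotone A B f
  IsQOrderPreserving⇒Monotone A B f (f-mem , f-hom) x y (x≡y , x≤xy) =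
    trans (f-mem x) (trans x≡y (sym (f-mem y))) ,
    ≤-trans (≤-reflexive (f-mem x)) (≤-trans x≤xy (f-hom x y))

  ⟦_⟧ : {X : QPreordered} → PElt X → Elt (sub (pre X)) → Carrier
  ⟦ l ⟧ = rel l tt

  ⟦compP⟧ : {X : QPreordered} (l : PElt X) (q v : Carrier) (d : DQ q (mem l) v) →
            ∀ z → ⟦ compP l q v d ⟧ z ≡ (⟦ l ⟧ ∘[ mem l ] v) z
  ⟦compP⟧ {X} l q v d = comp-𝟏 q (mem l) (sub (pre X)) (rel l) v

  ∘[]-identity : {X : QPreordered} (b : PElt X) {p : Carrier} → p ≡ mem b →
                 ∀ z → (⟦ b ⟧ ∘[ mem b ] p) z ≡ ⟦ b ⟧ z
  ∘[]-identity b refl z = proj₁ (isRelP b tt z)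

  hom†-DQ : {X : QPreordered} (a b : PElt X) → DQ (mem a) (mem b) (hom (P† X) a b)
  hom†-DQ a b = DQ-⋁ _ λ w → proj₁ (proj₂ w) tt tt

  -- hom (P† X) a b is the lift rel b ↘ rel a; these two lemmas are its universal property.
  module _ {X : QPreordered} (a b : PElt X) {v : Carrier} where

    ≤-hom⇒ : v ≤ hom (P† X) a b → ⟦ b ⟧ ∘[ mem b ] v ≤̇ ⟦ a ⟧
    ≤-hom⇒ v≤ab z = begin
      (⟦ b ⟧ z / mem b) & v                          ≤⟨ &-monoʳ _ v≤ab ⟩
      (⟦ b ⟧ z / mem b) & hom (P† X) a b             ≡⟨ &-distribˡ-⋁ _ _ ⟩
      ⋁ (λ w → (⟦ b ⟧ z / mem b) & proj₁ w tt tt)   ≤⟨ ⋁-least _ (λ (φ , _ , b∘φ≤a) →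
                                                          ≤-trans (⋁-upper _ tt) (b∘φ≤a tt z)) ⟩
      ⟦ a ⟧ z                                        ∎

    ⇒≤-hom : DQ (mem a) (mem b) v → ⟦ b ⟧ ∘[ mem b ] v ≤̇ ⟦ a ⟧ → v ≤ hom (P† X) a b
    ⇒≤-hom d b∘v≤a = ⋁-upper (λ w → proj₁ w tt tt)
      ((λ _ _ → v) , (λ _ _ → d) , λ _ z → ≤-trans (≤-reflexive (⋁-⊤ _)) (b∘v≤a z))

  infix 4 _≤†_
  record _≤†_ {X : QPreordered} (a b : PElt X) : Set where
    constructor ≤†-intro
    field
      mem-≡ : mem a ≡ mem b
      ⟦⟧-≥̇  : ⟦ b ⟧ ≤̇ ⟦ a ⟧
  open _≤†_ public

  module _ {X : QPreordered} where

    Under⇒≤† : {a b : PElt X} → Under (P† X) a b → a ≤† b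
    Under⇒≤† {a} {b} (a≡b , a≤ab) = ≤†-intro a≡b λ z →
      ≤-trans (≤-reflexive (sym (∘[]-identity b a≡b z))) (≤-hom⇒ a b a≤ab z)

    ≤†⇒Under : {a b : PElt X} → a ≤† b → Under (P† X) a b
    ≤†⇒Under {a} {b} (≤†-intro a≡b b≤a) = a≡b ,
      ⇒≤-hom a b (subst (λ p → DQ (mem a) p (mem a)) a≡b (DQ-refl (mem a)))
                 (λ z → ≤-trans (≤-reflexive (∘[]-identity b a≡b z)) (b≤a z))

    ≤†-refl : (a : PElt X) → a ≤† a
    ≤†-refl a = ≤†-intro refl λ _ → ≤-refl

    ≤†-trans : {a b c : PElt X} → a ≤† b → b ≤† c → a ≤† c
    ≤†-trans a≤b b≤c =
      ≤†-intro (trans (mem-≡ a≤b) (mem-≡ b≤c)) λ z → ≤-trans (⟦⟧-≥̇ b≤c z) (⟦⟧-≥̇ a≤b z)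

    ∘[]-antitone : {b b' : PElt X} (v : Carrier) → b ≤† b' →
                   ⟦ b' ⟧ ∘[ mem b' ] v ≤̇ ⟦ b ⟧ ∘[ mem b ] v
    ∘[]-antitone v b≤b' = ∘[]-mono (⟦⟧-≥̇ b≤b') (sym (mem-≡ b≤b'))

    module _ {μ : PElt X} (l : PElt X) (q v : Carrier) (d : DQ q (mem l) v) where

      ≤†compP⇒ : μ ≤† compP l q v d → ⟦ l ⟧ ∘[ mem l ] v ≤̇ ⟦ μ ⟧
      ≤†compP⇒ μ≤l∘v z = ≤-trans (≤-reflexive (sym (⟦compP⟧ l q v d z))) (⟦⟧-≥̇ μ≤l∘v z)

      ⇒≤†compP : mem μ ≡ q → ⟦ l ⟧ ∘[ mem l ] v ≤̇ ⟦ μ ⟧ → μ ≤† compP l q v d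
      ⇒≤†compP μ≡q l∘v≤μ = ≤†-intro μ≡q λ z → ≤-trans (≤-reflexive (⟦compP⟧ l q v d z)) (l∘v≤μ z)

    compP-hom : (l : PElt X) (q v : Carrier) (d : DQ q (mem l) v) → v ≤ hom (P† X) (compP l q v d) l
    compP-hom l q v d = ⇒≤-hom (compP l q v d) l d λ z → ≤-reflexive (sym (⟦compP⟧ l q v d z))

    ⋃ : {I : Set} (m : Carrier) (F : I → PElt X) → (∀ i → mem (F i) ≡ m) → PElt X
    ⋃ m F mem-F = record
      { mem = m
      ; rel = λ _ x → ⋁ λ i → ⟦ F i ⟧ x
      ; isRelP = λ _ x → DQ-⋁ _ λ i →
          subst (λ p → DQ p (∣ S ∣ x) (⟦ F i ⟧ x)) (mem-F i) (isRelP (F i) tt x)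
      ; closed = λ _ x → ⋁-least _ λ x' → begin
          (hom (pre X) x' x / ∣ S ∣ x') & ⋁ (λ i → ⟦ F i ⟧ x')
            ≡⟨ &-distribˡ-⋁ _ _ ⟩
          ⋁ (λ i → (hom (pre X) x' x / ∣ S ∣ x') & ⟦ F i ⟧ x')
            ≤⟨ ⋁-least _ (λ i → ≤-trans (⋁-upper _ x') (≤-trans (closed (F i) tt x) (⋁-upper _ i))) ⟩
          ⋁ (λ i → ⟦ F i ⟧ x)
            ∎
      }
      where S = sub (pre X)

    module _ {I : Set} {m : Carrier} (F : I → PElt X) (mem-F : ∀ i → mem (F i) ≡ m) where

      ⋃-lowerBound : ∀ i → ⋃ m F mem-F ≤† F i
      ⋃-lowerBound i = ≤†-intro (sym (mem-F i)) λ z → ⋁-upper (λ j → ⟦ F j ⟧ z) i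

      ⋃-greatest : {a : PElt X} → mem a ≡ m → (∀ i → a ≤† F i) → a ≤† ⋃ m F mem-F
      ⋃-greatest a≡m a≤F = ≤†-intro a≡m λ z → ⋁-least _ λ i → ⟦⟧-≥̇ (a≤F i) z

  -- The co-Yoneda decomposition l = ⋃_y (y† y ∘ l(y)).
  module _ {X : QPreordered} (l : PElt X) where

    y†∘ : Elt (sub (pre X)) → PElt X
    y†∘ y = compP (y† X y) (mem l) (⟦ l ⟧ y) (isRelP l tt y)

    ≤†y†∘ : ∀ y → l ≤† y†∘ y
    ≤†y†∘ y = ⇒≤†compP (y† X y) (mem l) (⟦ l ⟧ y) (isRelP l tt y) refl λ z →
      ≤-trans (⋁-upper (λ y' → (hom (pre X) y' z / ∣ sub (pre X) ∣ y') & ⟦ l ⟧ y') y)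
              (closed l tt z)

    ⋃y†∘≤† : ⋃ (mem l) y†∘ (λ _ → refl) ≤† l
    ⋃y†∘≤† = ≤†-intro refl λ z → begin
      ⟦ l ⟧ z                                  ≡⟨ &-identityˡ _ ⟨
      e & ⟦ l ⟧ z                              ≤⟨ &-monoˡ _ (/-intro (e&∣∣≤hom z)) ⟩
      (hom (pre X) z z / ∣ S ∣ z) & ⟦ l ⟧ z    ≡⟨ ⟦compP⟧ (y† X z) _ _ (isRelP l tt z) z ⟨
      ⟦ y†∘ z ⟧ z                              ≤⟨ ⋁-upper (λ y → ⟦ y†∘ y ⟧ z) z ⟩
      ⋁ (λ y → ⟦ y†∘ y ⟧ z)                    ∎
      where
      S = sub (pre X)
      e&∣∣≤hom : ∀ z → e & ∣ S ∣ z ≤ hom (pre X) z z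
      e&∣∣≤hom z = ≤-trans (≤-reflexive (&-identityˡ _)) (hom-refl X z)

  module RightAdjoint (X Y : QPreordered) (g : PElt Y → PElt X)
                      (g-mem : ∀ b → mem (g b) ≡ mem b)
                      (g-right : IsRightAdjointPre (P† X) (P† Y) g) where

    f : PElt X → PElt Y
    f = proj₁ (proj₂ g-right)

    g-mono : {b b' : PElt Y} → b ≤† b' → g b ≤† g b'
    g-mono b≤b' = Under⇒≤† (proj₁ g-right _ _ (≤†⇒Under b≤b'))

    f⊣g : ∀ {a b} → f a ≤† b ⇔ a ≤† g b
    f⊣g {a} {b} = mk⇔
      (λ fa≤b → Under⇒≤† (to (adjoint a b) (≤†⇒Under fa≤b)))
      (λ a≤gb → Under⇒≤† (from (adjoint a b) (≤†⇒Under a≤gb)))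
      where adjoint = proj₂ (proj₂ (proj₂ g-right))

    unit : ∀ a → a ≤† g (f a)
    unit a = to f⊣g (≤†-refl (f a))

    counit : ∀ b → f (g b) ≤† b
    counit b = from f⊣g (≤†-refl (g b))

    f-mem : ∀ a → mem (f a) ≡ mem a
    f-mem a = sym (trans (mem-≡ (unit a)) (g-mem (f a)))

    g-⋃ : {I : Set} {m : Carrier} (F : I → PElt Y) (mem-F : ∀ i → mem (F i) ≡ m) →
          ⋃ m (g ∘ F) (λ i → trans (g-mem (F i)) (mem-F i)) ≤† g (⋃ m F mem-F)
    g-⋃ F mem-F =
      to f⊣g (⋃-greatest F mem-F (f-mem _) λ i → from f⊣g (⋃-lowerBound (g ∘ F) mem-gF i))
      where mem-gF = λ i → trans (g-mem (F i)) (mem-F i)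

  module QGalois (X Y : QPreordered) (f : PElt X → PElt Y) (g : PElt Y → PElt X)
                 (f⊣g : IsQGalois (P† X) (P† Y) f g) where

    private
      f-op = proj₁ f⊣g
      g-op = proj₁ (proj₂ f⊣g)
      g-mono = IsQOrderPreserving⇒Monotone (P† Y) (P† X) g g-op
      f-mono = IsQOrderPreserving⇒Monotone (P† X) (P† Y) f f-op

      unit : ∀ a → a ≤† g (f a)
      unit a = Under⇒≤† (proj₁ (proj₂ (proj₂ f⊣g)) a)

      counit : ∀ b → f (g b) ≤† b
      counit b = Under⇒≤† (proj₂ (proj₂ (proj₂ f⊣g)) b)

    isRightAdjointPre : IsRightAdjointPre (P† X) (P† Y) g
    isRightAdjointPre = g-mono , f , f-mono , λ a b → mk⇔
      (λ fa≤b → ≤†⇒Under (≤†-trans (unit a) (Under⇒≤† {b = g b} (g-mono (f a) b fa≤b))))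
      (λ a≤gb → ≤†⇒Under (≤†-trans (Under⇒≤† {a = f a} (f-mono a (g b) a≤gb)) (counit b)))

    module _ (l : PElt Y) (q v : Carrier) (d : DQ q (mem l) v) where

      private
        L = compP l q v d
        d-gl : DQ q (mem (g l)) v
        d-gl = subst (λ p → DQ q p v) (sym (proj₁ g-op l)) d

      gl∘v≤̇g[l∘v] : ⟦ g l ⟧ ∘[ mem (g l) ] v ≤̇ ⟦ g L ⟧
      gl∘v≤̇g[l∘v] z = ≤-trans (≤-hom⇒ (g (f (g L))) (g l) v≤hom[gfgL,gl] z) (⟦⟧-≥̇ (unit (g L)) z)
        where
        v≤hom[fgL,l] : v ≤ hom (P† Y) (f (g L)) l
        v≤hom[fgL,l] = ⇒≤-hom (f (g L)) l
          (subst (λ p → DQ p (mem l) v) (sym (trans (proj₁ f-op (g L)) (proj₁ g-op L))) d)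
          (≤†compP⇒ l q v d (counit L))
        v≤hom[gfgL,gl] : v ≤ hom (P† X) (g (f (g L))) (g l)
        v≤hom[gfgL,gl] = ≤-trans v≤hom[fgL,l] (proj₂ g-op (f (g L)) l)

      g[l∘v]≤̇gl∘v : ⟦ g L ⟧ ≤̇ ⟦ g l ⟧ ∘[ mem (g l) ] v
      g[l∘v]≤̇gl∘v z = ≤-trans (⟦⟧-≥̇ C≤gL z) (≤-reflexive (⟦compP⟧ (g l) q v d-gl z))
        where
        C = compP (g l) q v d-gl
        v≤hom[fC,fgl] : v ≤ hom (P† Y) (f C) (f (g l))
        v≤hom[fC,fgl] = ≤-trans (compP-hom (g l) q v d-gl) (proj₂ f-op C (g l))
        fC≤L : f C ≤† L
        fC≤L = ⇒≤†compP l q v d (proj₁ f-op C) λ z' →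
          ≤-trans (∘[]-antitone v (counit l) z') (≤-hom⇒ (f C) (f (g l)) v≤hom[fC,fgl] z')
        C≤gL : C ≤† g L
        C≤gL = ≤†-trans (unit C) (Under⇒≤† (g-mono (f C) L (≤†⇒Under fC≤L)))

      g-compP : EqR (𝟏 q) (sub (pre X)) (rel (g L))
                    (comp (𝟏 q) (𝟏 (mem l)) (sub (pre X)) (rel (g l)) (λ _ _ → v))
      g-compP _ z = begin-equality
        ⟦ g L ⟧ z                          ≡⟨ ≤-antisym (g[l∘v]≤̇gl∘v z) (gl∘v≤̇g[l∘v] z) ⟩
        (⟦ g l ⟧ ∘[ mem (g l) ] v) z       ≡⟨ cong (λ p → (⟦ g l ⟧ z / p) & v) (proj₁ g-op l) ⟩
        (⟦ g l ⟧ ∘[ mem l ] v) z           ≡⟨ comp-𝟏 q (mem l) (sub (pre X)) (rel (g l)) v z ⟨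
        comp (𝟏 q) (𝟏 (mem l)) (sub (pre X)) (rel (g l)) (λ _ _ → v) tt z  ∎

  module FromCondIII (X Y : QPreordered) (g : PElt Y → PElt X)
                     (g-op : IsQOrderPreserving (P† Y) (P† X) g) (iii : CondIII X Y g) where

    open RightAdjoint X Y g (proj₁ g-op) (proj₁ iii)

    g-y†∘ : ∀ y q v (d : DQ q (∣ sub (pre Y) ∣ y) v) →
            ∀ x → ⟦ g (compP (y† Y y) q v d) ⟧ x ≡ (⟦ g (y† Y y) ⟧ ∘[ ∣ sub (pre Y) ∣ y ] v) x
    g-y†∘ y q v d x =
      trans (proj₂ iii y q v d tt x) (comp-𝟏 q _ (sub (pre X)) (rel (g (y† Y y))) v x)

    module _ (ν : PElt Y) {m u : Carrier} (d : DQ m (mem ν) u) where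

      private
        L = compP ν m u d

      g[y†∘L]≤̇gν∘u : ∀ y → ⟦ g (y†∘ L y) ⟧ ≤̇ ⟦ g ν ⟧ ∘[ mem ν ] u
      g[y†∘L]≤̇gν∘u y x = begin
        ⟦ g (y†∘ L y) ⟧ x                  ≡⟨ g-y†∘ y m (⟦ L ⟧ y) (isRelP L tt y) x ⟩
        (A / p) & ⟦ L ⟧ y                  ≡⟨ cong ((A / p) &_) (⟦compP⟧ ν m u d y) ⟩
        (A / p) & ((⟦ ν ⟧ y / mem ν) & u)  ≡⟨ &-assoc _ _ _ ⟨
        ((A / p) & (⟦ ν ⟧ y / mem ν)) & u  ≤⟨ &-monoˡ u &-/ ⟩
        (((A / p) & ⟦ ν ⟧ y) / mem ν) & u  ≡⟨ cong (λ t → (t / mem ν) & u)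
                                                (g-y†∘ y (mem ν) (⟦ ν ⟧ y) (isRelP ν tt y) x) ⟨
        (⟦ g (y†∘ ν y) ⟧ x / mem ν) & u    ≤⟨ &-monoˡ u (/-mono (⟦⟧-≥̇ (g-mono (≤†y†∘ ν y)) x)) ⟩
        (⟦ g ν ⟧ x / mem ν) & u            ∎
        where
        p = ∣ sub (pre Y) ∣ y
        A = ⟦ g (y† Y y) ⟧ x

      g[ν∘u]≤̇gν∘u : ⟦ g L ⟧ ≤̇ ⟦ g ν ⟧ ∘[ mem ν ] u
      g[ν∘u]≤̇gν∘u x = begin
        ⟦ g L ⟧ x                            ≤⟨ ⟦⟧-≥̇ (g-mono (⋃y†∘≤† L)) x ⟩
        ⟦ g (⋃ m (y†∘ L) (λ _ → refl)) ⟧ x   ≤⟨ ⟦⟧-≥̇ (g-⋃ (y†∘ L) (λ _ → refl)) x ⟩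
        ⋁ (λ y → ⟦ g (y†∘ L y) ⟧ x)          ≤⟨ ⋁-least _ (λ y → g[y†∘L]≤̇gν∘u y x) ⟩
        (⟦ g ν ⟧ x / mem ν) & u              ∎

    f-hom : ∀ a a' → hom (P† X) a a' ≤ hom (P† Y) (f a) (f a')
    f-hom a a' = ⇒≤-hom (f a) (f a') (subst (λ p → DQ p (mem (f a')) u) (sym (f-mem a)) d)
                        (≤†compP⇒ (f a') (mem a) u d (from f⊣g a≤gC))
      where
      u = hom (P† X) a a'
      d : DQ (mem a) (mem (f a')) u
      d = subst (λ p → DQ (mem a) p u) (sym (f-mem a')) (hom†-DQ a a')
      C = compP (f a') (mem a) u d
      a≤gC : a ≤† g C
      a≤gC = ≤†-intro (sym (proj₁ g-op C)) λ x → begin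
        ⟦ g C ⟧ x                               ≤⟨ g[ν∘u]≤̇gν∘u (f a') d x ⟩
        (⟦ g (f a') ⟧ ∘[ mem (f a') ] u) x      ≤⟨ ∘[]-mono (⟦⟧-≥̇ (unit a')) (f-mem a') x ⟩
        (⟦ a' ⟧ ∘[ mem a' ] u) x                ≤⟨ ≤-hom⇒ a a' ≤-refl x ⟩
        ⟦ a ⟧ x                                 ∎

    condI : CondI X Y g
    condI = f , (f-mem , f-hom) , g-op , ≤†⇒Under ∘ unit , ≤†⇒Under ∘ counit

  CondI⇒CondII : (X Y : QPreordered) (g : PElt Y → PElt X) → CondI X Y g → CondII X Y g
  CondI⇒CondII X Y g (f , f⊣g) = isRightAdjointPre , g-compP
    where open QGalois X Y f g f⊣g

  CondII⇒CondIII : (X Y : QPreordered) (g : PElt Y → PElt X) → CondII X Y g → CondIII X Y g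
  CondII⇒CondIII X Y g (g-right , g-compP) = g-right , λ y → g-compP (y† Y y)

  CondIII⇒CondI : (X Y : QPreordered) (g : PElt Y → PElt X) →
                  IsQOrderPreserving (P† Y) (P† X) g → CondIII X Y g → CondI X Y g
  CondIII⇒CondI X Y g g-op iii = FromCondIII.condI X Y g g-op iii

proposition4p16 :
    (Q : Quantale) →
    ¬ (Theory.⊥Q Q ≡ Quantale.e Q) →
    (X Y : Theory.QPreordered Q) →
    (g : Theory.PElt Q Y → Theory.PElt Q X) →
    Theory.IsQOrderPreserving Q (Theory.P† Q Y) (Theory.P† Q X) g →
    (Theory.CondI Q X Y g ⇔ Theory.CondII Q X Y g) ×
    (Theory.CondI Q X Y g ⇔ Theory.CondIII Q X Y g)
proposition4p16 Q _ X Y g g-op =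
  mk⇔ (CondI⇒CondII X Y g) (CondIII⇒CondI X Y g g-op ∘ CondII⇒CondIII X Y g) ,
  mk⇔ (CondII⇒CondIII X Y g ∘ CondI⇒CondII X Y g) (CondIII⇒CondI X Y g g-op)
  where open CoPresheaves Q
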